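{- Let $k\geq 2$ be an integer and let $T$ be a tree with exactly $k$ pendant vertices (vertices of degree $1$). Then $Sd_k(T)\leq d+(k-2)\left\lfloor \frac{d}{2}\right\rfloor$, where $d$ is the diameter of $T$.
   Context: For a graph $G$ and $S\subseteq V(G)$, the Steiner distance $d_G(S)$ is the minimum number of edges of a connected subgraph of $G$ (equivalently, of a subtree of $G$) whose vertex set contains $S$. For $k\geq 2$ with $|V(G)|\geq k$, the Steiner $k$-diameter $Sd_k(G)$ is the maximum of $d_G(S)$ over all $k$-subsets $S\subseteq V(G)$ (equivalently, the maximum over vertices $v$ of the Steiner $k$-eccentricity $\max\{d_G(S): v\in S,\ |S|=k\}$). -}

module Defs where

open import Data.Nat using (ℕ; zero; suc; _+_; _≤_; _<_; _≡ᵇ_)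
open import Data.Bool using (Bool; true; false; if_then_else_)
open import Data.Fin using (Fin; toℕ)
open import Data.Fin.Subset using (Subset; _∈_; _⊆_; ∣_∣)
open import Data.List using (List; []; _∷_; _∷ʳ_; length; map; allFin)
open import Data.Nat.ListAction using (sum)
open import Data.List.Relation.Unary.Linked using (Linked)
open import Data.List.Relation.Unary.Unique.Propositional using (Unique)
open import Data.Product using (Σ; _×_; ∃; ∃-syntax)
open import Relation.Binary.PropositionalEquality using (_≡_)
open import Relation.Nullary using (¬_)
open import Relation.Nullary.Decidable using (⌊_⌋)
open import Data.Nat using (_<?_)

record Graph (n : ℕ) : Set where
  field
    adj    : Fin n → Fin n → Bool
    sym    : ∀ i j → adj i j ≡ adj j i
    irrefl : ∀ i → adj i i ≡ false
open Graph public

data Walk {n : ℕ} (E : Fin n → Fin n → Bool) : Fin n → Fin n → ℕ → Set where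
  here : ∀ {u} → Walk E u u 0
  step : ∀ {u w v m} → E u w ≡ true → Walk E w v m → Walk E u v (suc m)

Connected : ∀ {n} → Graph n → Set
Connected G = ∀ u v → ∃[ m ] Walk (adj G) u v m

Adjacent : ∀ {n} → Graph n → Fin n → Fin n → Set
Adjacent G i j = adj G i j ≡ true

HasCycle : ∀ {n} → Graph n → Set
HasCycle {n} G = ∃[ x ] ∃[ xs ]
  (2 ≤ length xs × Unique (x ∷ xs) × Linked (Adjacent G) ((x ∷ xs) ∷ʳ x))

IsTree : ∀ {n} → Graph n → Set
IsTree G = Connected G × ¬ HasCycle G

degree : ∀ {n} → Graph n → Fin n → ℕ
degree {n} G v = sum (map (λ j → if adj G v j then 1 else 0) (allFin n))

pendantCount : ∀ {n} → Graph n → ℕ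
pendantCount {n} G = sum (map (λ v → if degree G v ≡ᵇ 1 then 1 else 0) (allFin n))

IsDiameter : ∀ {n} → Graph n → ℕ → Set
IsDiameter G d =
  (∀ u v → ∃[ m ] (m ≤ d × Walk (adj G) u v m)) ×
  (∃[ u ] ∃[ v ] (∀ m → Walk (adj G) u v m → d ≤ m))

record Subgraph {n : ℕ} (G : Graph n) : Set where
  field
    verts     : Subset n
    edges     : Fin n → Fin n → Bool
    edges-sub : ∀ i j → edges i j ≡ true → adj G i j ≡ true
    edges-sym : ∀ i j → edges i j ≡ edges j i
    edges-end : ∀ i j → edges i j ≡ true → (i ∈ verts × j ∈ verts)
open Subgraph public

SubConnected : ∀ {n} {G : Graph n} → Subgraph G → Set
SubConnected H = ∀ u v → u ∈ verts H → v ∈ verts H → ∃[ m ] Walk (edges H) u v m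

edgeCount : ∀ {n} {G : Graph n} → Subgraph G → ℕ
edgeCount {n} H = sum (map (λ i → sum (map (λ j →
  if ⌊ toℕ i <? toℕ j ⌋ then (if edges H i j then 1 else 0) else 0) (allFin n))) (allFin n))

-- d_G(S) ≤ m : some connected subgraph whose vertex set contains S has at most m edges.
SteinerDistLe : ∀ {n} → Graph n → Subset n → ℕ → Set
SteinerDistLe G S m = ∃[ H ] (SubConnected {G = G} H × S ⊆ verts H × edgeCount {G = G} H ≤ m)

SteinerDiamLe : ∀ {n} → Graph n → ℕ → ℕ → Set
SteinerDiamLe {n} G k m = ∀ (S : Subset n) → ∣ S ∣ ≡ k → SteinerDistLe G S m

module Submission where

-- The whole tree is a connected subgraph containing every S, so it suffices to bound its
-- number of edges, i.e. of non-root vertices once the tree is rooted at a leaf r. Send each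
-- non-root vertex v to its heavy leaf, the deepest leaf below v: the fibres of this map are
-- vertical paths ending in leaves. The fibre of the heavy leaf of r's only child has at most
-- d vertices. For any other fibre, the parent p of its top vertex has a different heavy leaf
-- ℓ′, at least as deep as the fibre's own leaf ℓ; the walk from ℓ to ℓ′ passes through p, so
-- d ≥ 2 (depth ℓ − depth p) and the fibre has at most ⌊d/2⌋ vertices. Besides r and the main
-- leaf there are at most k − 2 leaves.

open import Data.Bool using (Bool; true; false; if_then_else_; T)
open import Data.Unit using (tt)
open import Data.Bool.Properties using () renaming (_≟_ to _≟B_)
open import Data.Empty using (⊥-elim)
open import Data.Fin using (Fin; zero; suc; toℕ; fromℕ<)
open import Data.Fin.Subset using (⊤)
open import Data.Fin.Subset.Properties using (∈⊤)
open import Data.Fin.Properties using (toℕ-fromℕ<; any?; toℕ<n; toℕ-injective)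
  renaming (_≟_ to _≟F_; suc-injective to Fin-suc-injective)
open import Data.List using (List; []; _∷_; _∷ʳ_; map; tabulate; allFin; applyUpTo)
open import Data.List.Properties using (length-applyUpTo)
open import Data.List.Membership.Propositional using (_∈_)
open import Data.List.Membership.Propositional.Properties using (∈-allFin)
open import Data.List.Relation.Unary.Any using (here; there)
open import Data.List.Relation.Unary.All.Properties using (applyUpTo⁺₁)
open import Data.List.Relation.Unary.AllPairs using ([]; _∷_)
open import Data.List.Relation.Unary.Linked using (Linked; []; [-]; _∷_)
open import Data.List.Relation.Unary.Unique.Propositional using (Unique)
import Data.Nat.ListAction as ListAction
open import Data.Nat
open import Data.Nat.Properties
open import Data.Product using (∃; ∃-syntax; _×_; _,_; proj₁; proj₂)
open import Data.Sum using (_⊎_; inj₁; inj₂)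
open import Relation.Binary using (tri<; tri≈; tri>)
open import Function using (_∘_)
open import Relation.Nullary using (Dec; yes; no; ¬_)
open import Relation.Nullary.Decidable using (⌊_⌋; _×-dec_; ¬?)
open import Relation.Binary.PropositionalEquality
open import Algebra.Properties.Semiring.Sum +-*-semiring
  using (sum; sum-syntax; sum-cong-≗; ∑-distrib-+; ∑-comm; *-distribˡ-sum)

open import Defs hiding (sym)

boolToℕ : Bool → ℕ
boolToℕ b = if b then 1 else 0

boolToℕ-positive : ∀ {b} → 0 < boolToℕ b → b ≡ true
boolToℕ-positive {true} _ = refl

decToℕ : ∀ {p} {P : Set p} → Dec P → ℕ
decToℕ P? = boolToℕ ⌊ P? ⌋

decToℕ-yes : ∀ {p} {P : Set p} (P? : Dec P) → P → decToℕ P? ≡ 1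
decToℕ-yes (yes _) _ = refl
decToℕ-yes (no ¬p) x = ⊥-elim (¬p x)

decToℕ-no : ∀ {p} {P : Set p} (P? : Dec P) → ¬ P → decToℕ P? ≡ 0
decToℕ-no (yes x) ¬p = ⊥-elim (¬p x)
decToℕ-no (no _) _ = refl

sum-allFin : ∀ n (f : Fin n → ℕ) → ListAction.sum (map f (allFin n)) ≡ ∑[ i < n ] f i
sum-allFin n f = go n (λ i → i)
  where
  go : ∀ m (g : Fin m → Fin n) → ListAction.sum (map f (tabulate g)) ≡ ∑[ i < m ] f (g i)
  go zero g = refl
  go (suc m) g = cong (f (g zero) +_) (go m (g ∘ suc))

sum-mono-≤ : ∀ {n} {f g : Fin n → ℕ} → (∀ i → f i ≤ g i) → sum f ≤ sum g
sum-mono-≤ {zero} f≤g = z≤n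
sum-mono-≤ {suc n} f≤g = +-mono-≤ (f≤g zero) (sum-mono-≤ (f≤g ∘ suc))

sum-ones : ∀ n → ∑[ i < n ] 1 ≡ n
sum-ones zero = refl
sum-ones (suc n) = cong suc (sum-ones n)

sum-zero : ∀ {n} (f : Fin n → ℕ) → (∀ i → f i ≡ 0) → sum f ≡ 0
sum-zero {zero} f f≡0 = refl
sum-zero {suc n} f f≡0 = cong₂ _+_ (f≡0 zero) (sum-zero (f ∘ suc) (f≡0 ∘ suc))

sum-single : ∀ {n} (f : Fin n → ℕ) c → (∀ i → i ≢ c → f i ≡ 0) → sum f ≡ f c
sum-single f zero f≡0 =
  trans (cong (f zero +_) (sum-zero (f ∘ suc) (λ i → f≡0 (suc i) λ ()))) (+-identityʳ (f zero))
sum-single f (suc c) f≡0 =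
  cong₂ _+_ (f≡0 zero λ ()) (sum-single (f ∘ suc) c (λ i i≢c → f≡0 (suc i) (i≢c ∘ Fin-suc-injective)))

term≤sum : ∀ {n} (f : Fin n → ℕ) c → f c ≤ sum f
term≤sum f zero = m≤m+n _ _
term≤sum f (suc c) = ≤-trans (term≤sum (f ∘ suc) c) (m≤n+m _ _)

twoTerms≤sum : ∀ {n} (f : Fin n → ℕ) a b → a ≢ b → f a + f b ≤ sum f
twoTerms≤sum f zero zero a≢b = ⊥-elim (a≢b refl)
twoTerms≤sum f zero (suc b) _ = +-monoʳ-≤ (f zero) (term≤sum (f ∘ suc) b)
twoTerms≤sum f (suc a) zero _ =
  subst (_≤ sum f) (+-comm (f zero) _) (+-monoʳ-≤ (f zero) (term≤sum (f ∘ suc) a))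
twoTerms≤sum f (suc a) (suc b) a≢b =
  ≤-trans (twoTerms≤sum (f ∘ suc) a b (a≢b ∘ cong suc)) (m≤n+m _ _)

positive-term : ∀ {n} (f : Fin n → ℕ) → 0 < sum f → ∃[ i ] 0 < f i
positive-term {suc n} f sum>0 with f zero in eq
... | suc _ = zero , subst (0 <_) (sym eq) (s≤s z≤n)
... | zero = let (i , fi>0) = positive-term (f ∘ suc) sum>0 in suc i , fi>0

sum-indicator : ∀ {n} (c : Fin n) → ∑[ i < n ] decToℕ (c ≟F i) ≡ 1
sum-indicator c =
  trans (sum-single _ c (λ i i≢c → decToℕ-no (c ≟F i) (i≢c ∘ sym))) (decToℕ-yes (c ≟F c) refl)

count-≤ : ∀ {n} {P : Fin n → Set} (P? : ∀ v → Dec (P v)) M (g : ℕ → Fin n) →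
  (∀ v → P v → ∃[ i ] (i < M × g i ≡ v)) → ∑[ v < n ] decToℕ (P? v) ≤ M
count-≤ {n} P? M g covered = begin
  ∑[ v < n ] decToℕ (P? v)        ≤⟨ sum-mono-≤ hit ⟩
  ∑[ v < n ] ∑[ i < M ] δ i v     ≡⟨ ∑-comm {n} {M} (λ v i → δ i v) ⟩
  ∑[ i < M ] ∑[ v < n ] δ i v     ≡⟨ sum-cong-≗ {M} (λ i → sum-indicator (g (toℕ i))) ⟩
  ∑[ i < M ] 1                    ≡⟨ sum-ones M ⟩
  M                               ∎
  where
  open ≤-Reasoning
  δ : Fin M → Fin n → ℕ
  δ i v = decToℕ (g (toℕ i) ≟F v)
  hit : ∀ v → decToℕ (P? v) ≤ ∑[ i < M ] δ i v
  hit v with P? v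
  ... | no _ = z≤n
  ... | yes pv with covered v pv
  ... | i , i<M , gi≡v = begin
    1                         ≡⟨ decToℕ-yes (g (toℕ (fromℕ< i<M)) ≟F v) (trans (cong g (toℕ-fromℕ< i<M)) gi≡v) ⟨
    δ (fromℕ< i<M) v          ≤⟨ term≤sum (λ i → δ i v) (fromℕ< i<M) ⟩
    ∑[ i < M ] δ i v          ∎

upper : ∀ {n} → (Fin n → Fin n → ℕ) → Fin n → Fin n → ℕ
upper f i j = if ⌊ toℕ i <? toℕ j ⌋ then f i j else 0

upper+lower≤ : ∀ {n} (f : Fin n → Fin n → ℕ) i j → upper f i j + upper (λ i′ j′ → f j′ i′) j i ≤ f i j
upper+lower≤ f i j with toℕ i <? toℕ j | toℕ j <? toℕ i
... | yes i<j | yes j<i = ⊥-elim (<-asym i<j j<i)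
... | yes _   | no _    = ≤-reflexive (+-identityʳ _)
... | no _    | yes _   = ≤-refl
... | no _    | no _    = z≤n

sum-upper+upper≤sum : ∀ {n} (f : Fin n → Fin n → ℕ) →
  ∑[ i < n ] ∑[ j < n ] (upper f i j + upper (λ i′ j′ → f j′ i′) i j) ≤ ∑[ i < n ] ∑[ j < n ] f i j
sum-upper+upper≤sum {n} f = begin
  ∑[ i < n ] ∑[ j < n ] (U i j + Uᵀ i j)
    ≡⟨ sum-cong-≗ {n} (λ i → ∑-distrib-+ (U i) (Uᵀ i)) ⟩
  ∑[ i < n ] (∑[ j < n ] U i j + ∑[ j < n ] Uᵀ i j)
    ≡⟨ ∑-distrib-+ (λ i → ∑[ j < n ] U i j) _ ⟩
  ∑[ i < n ] ∑[ j < n ] U i j + ∑[ i < n ] ∑[ j < n ] Uᵀ i j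
    ≡⟨ cong (∑[ i < n ] ∑[ j < n ] U i j +_) (∑-comm {n} {n} Uᵀ) ⟩
  ∑[ i < n ] ∑[ j < n ] U i j + ∑[ j < n ] ∑[ i < n ] Uᵀ i j
    ≡⟨ ∑-distrib-+ (λ i → ∑[ j < n ] U i j) _ ⟨
  ∑[ i < n ] (∑[ j < n ] U i j + ∑[ j < n ] Uᵀ j i)
    ≡⟨ sum-cong-≗ {n} (λ i → ∑-distrib-+ (U i) (λ j → Uᵀ j i)) ⟨
  ∑[ i < n ] ∑[ j < n ] (U i j + Uᵀ j i)
    ≤⟨ sum-mono-≤ (λ i → sum-mono-≤ (upper+lower≤ f i)) ⟩
  ∑[ i < n ] ∑[ j < n ] f i j
    ∎
  where
  open ≤-Reasoning
  U Uᵀ : Fin n → Fin n → ℕ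
  U = upper f
  Uᵀ = upper (λ i′ j′ → f j′ i′)

double≤⇒≤half : ∀ {t d} → t + t ≤ d → t ≤ ⌊ d /2⌋
double≤⇒≤half {t} t+t≤d = subst (_≤ _) (sym (n≡⌊n+n/2⌋ t)) (⌊n/2⌋-mono t+t≤d)

least : (P : ℕ → Set) → (∀ i → Dec (P i)) → ∀ M → P M → ∃[ j ] (P j × (∀ i → i < j → ¬ P i))
least P P? M pM with P? 0
... | yes p0 = 0 , p0 , λ _ ()
least P P? zero pM | no ¬p0 = ⊥-elim (¬p0 pM)
least P P? (suc M) pM | no ¬p0 with least (P ∘ suc) (P? ∘ suc) M pM
... | j , pj , below = suc j , pj , λ { zero _ → ¬p0 ; (suc i) (s≤s i<j) → below i i<j }

lastBefore : (P : ℕ → Set) → (∀ i → Dec (P i)) → ∀ M → P 0 → ¬ P M →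
  ∃[ s ] (s < M × P s × ¬ P (suc s))
lastBefore P P? zero p0 ¬pM = ⊥-elim (¬pM p0)
lastBefore P P? (suc M) p0 ¬pM with P? 1
... | no ¬p1 = 0 , s≤s z≤n , p0 , ¬p1
... | yes p1 with lastBefore (P ∘ suc) (P? ∘ suc) M p1 ¬pM
... | s , s<M , ps , ¬ps+1 = suc s , s≤s s<M , ps , ¬ps+1

module ArgMax {A : Set} {P : A → Set} (P? : ∀ x → Dec (P x)) (key : A → ℕ) where

  argmax : List A → A → A
  argmax [] default = default
  argmax (y ∷ ys) default with P? y | key (argmax ys default) <? key y
  ... | yes _ | yes _ = y
  ... | _     | _     = argmax ys default

  argmax-satisfies : ∀ ys default → P default → P (argmax ys default)
  argmax-satisfies [] default p = p
  argmax-satisfies (y ∷ ys) default p with P? y | key (argmax ys default) <? key y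
  ... | yes py | yes _ = py
  ... | yes _  | no _  = argmax-satisfies ys default p
  ... | no _   | _     = argmax-satisfies ys default p

  argmax-maximal : ∀ ys default z → z ∈ ys → P z → key z ≤ key (argmax ys default)
  argmax-maximal (y ∷ ys) default z z∈ pz with P? y | key (argmax ys default) <? key y
  argmax-maximal (y ∷ ys) default .y (here refl) pz | yes _ | yes _ = ≤-refl
  argmax-maximal (y ∷ ys) default z (there z∈) pz | yes _ | yes larger =
    ≤-trans (argmax-maximal ys default z z∈ pz) (<⇒≤ larger)
  argmax-maximal (y ∷ ys) default .y (here refl) pz | yes _ | no notLarger = ≮⇒≥ notLarger
  argmax-maximal (y ∷ ys) default z (there z∈) pz | yes _ | no _ = argmax-maximal ys default z z∈ pz
  argmax-maximal (y ∷ ys) default .y (here refl) pz | no ¬py | _ = ⊥-elim (¬py pz)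
  argmax-maximal (y ∷ ys) default z (there z∈) pz | no _ | _ = argmax-maximal ys default z z∈ pz

applyUpTo-unique : ∀ {A : Set} m (f : ℕ → A) →
  (∀ i i′ → i < m → i′ < m → f i ≡ f i′ → i ≡ i′) → Unique (applyUpTo f m)
applyUpTo-unique zero f _ = []
applyUpTo-unique (suc m) f injective =
  applyUpTo⁺₁ (f ∘ suc) m (λ i<m fi≡f0 → 0≢1+n (injective 0 _ (s≤s z≤n) (s≤s i<m) fi≡f0))
  ∷ applyUpTo-unique m (f ∘ suc)
      (λ i i′ i<m i′<m eq → suc-injective (injective (suc i) (suc i′) (s≤s i<m) (s≤s i′<m) eq))

applyUpTo-linked : ∀ {A : Set} {R : A → A → Set} L (f : ℕ → A) y →
  (∀ i → i < L → R (f i) (f (suc i))) → R (f L) y → Linked R (applyUpTo f (suc L) ∷ʳ y)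
applyUpTo-linked zero f y _ last = last ∷ [-]
applyUpTo-linked (suc L) f y consecutive last =
  consecutive 0 (s≤s z≤n) ∷ applyUpTo-linked L (f ∘ suc) y (λ i i<L → consecutive (suc i) (s≤s i<L)) last

closedWalk⇒hasCycle : ∀ {n} (G : Graph n) L → 2 ≤ L → (f : ℕ → Fin n) →
  (∀ i → i < L → Adjacent G (f i) (f (suc i))) → Adjacent G (f L) (f 0) →
  (∀ i i′ → i ≤ L → i′ ≤ L → f i ≡ f i′ → i ≡ i′) → HasCycle G
closedWalk⇒hasCycle G L 2≤L f consecutive closing injective =
  f 0 , applyUpTo (f ∘ suc) L ,
  subst (2 ≤_) (sym (length-applyUpTo (f ∘ suc) L)) 2≤L ,
  applyUpTo-unique (suc L) f (λ i i′ i≤L i′≤L → injective i i′ (≤-pred i≤L) (≤-pred i′≤L)) ,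
  applyUpTo-linked L f (f 0) consecutive closing

wholeSubgraph : ∀ {n} (G : Graph n) → Subgraph G
wholeSubgraph G = record
  { verts = ⊤ ; edges = adj G ; edges-sub = λ _ _ e → e ; edges-sym = Graph.sym G
  ; edges-end = λ _ _ _ → ∈⊤ , ∈⊤ }

module Rooted {n : ℕ} (G : Graph n) (connected : Connected G) (r : Fin n) where

  infix 4 _~_
  _~_ : Fin n → Fin n → Set
  u ~ v = Adjacent G u v

  ~-sym : ∀ {u v} → u ~ v → v ~ u
  ~-sym {u} {v} u~v = trans (Graph.sym G v u) u~v

  ReachesRootWithin : ℕ → Fin n → Set
  ReachesRootWithin m v = ∃[ m′ ] (m′ ≤ m × Walk (adj G) v r m′)

  reachesRootWithin? : ∀ m v → Dec (ReachesRootWithin m v)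
  reachesRootWithin? zero v with v ≟F r
  ... | yes refl = yes (0 , z≤n , here)
  ... | no v≢r = no λ { (.0 , z≤n , here) → v≢r refl }
  reachesRootWithin? (suc m) v with reachesRootWithin? m v
  ... | yes (m′ , m′≤m , w) = yes (m′ , m≤n⇒m≤1+n m′≤m , w)
  ... | no ¬within with any? (λ w → (adj G v w ≟B true) ×-dec reachesRootWithin? m w)
  ... | yes (w , v~w , (m′ , m′≤m , walk)) = yes (suc m′ , s≤s m′≤m , step v~w walk)
  ... | no ¬step = no λ
    { (.0 , _ , here) → ¬within (0 , z≤n , here)
    ; (suc m′ , s≤s m′≤m , step {w = w} v~w walk) → ¬step (w , v~w , (m′ , m′≤m , walk)) }

  private
    shortest : ∀ v → ∃[ j ] (ReachesRootWithin j v × (∀ i → i < j → ¬ ReachesRootWithin i v))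
    shortest v = least (λ m → ReachesRootWithin m v) (λ m → reachesRootWithin? m v)
      (proj₁ (connected v r)) (proj₁ (connected v r) , ≤-refl , proj₂ (connected v r))

  depth : Fin n → ℕ
  depth v = proj₁ (shortest v)

  depth-≤-walk : ∀ {v m} → Walk (adj G) v r m → depth v ≤ m
  depth-≤-walk {v} {m} walk with m <? depth v
  ... | yes m<depth = ⊥-elim (proj₂ (proj₂ (shortest v)) m m<depth (m , ≤-refl , walk))
  ... | no m≮depth = ≮⇒≥ m≮depth

  walkToRoot : ∀ v → Walk (adj G) v r (depth v)
  walkToRoot v with proj₁ (proj₂ (shortest v))
  ... | m , m≤depth , walk = subst (Walk (adj G) v r) (≤-antisym m≤depth (depth-≤-walk walk)) walk

  depth-root : depth r ≡ 0
  depth-root = n≤0⇒n≡0 (depth-≤-walk here)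

  depth≡0⇒root : ∀ {v} → depth v ≡ 0 → v ≡ r
  depth≡0⇒root {v} depth≡0 = endpoint (subst (Walk (adj G) v r) depth≡0 (walkToRoot v))
    where
    endpoint : Walk (adj G) v r 0 → v ≡ r
    endpoint here = refl

  nonroot⇒depth>0 : ∀ {v} → v ≢ r → 0 < depth v
  nonroot⇒depth>0 {v} v≢r with depth v in eq
  ... | zero = ⊥-elim (v≢r (depth≡0⇒root eq))
  ... | suc _ = s≤s z≤n

  depth>0⇒nonroot : ∀ {v} → 0 < depth v → v ≢ r
  depth>0⇒nonroot depth>0 refl = <⇒≢ depth>0 (sym depth-root)

  depth-adj : ∀ {u v} → u ~ v → depth u ≤ suc (depth v)
  depth-adj {u} {v} u~v = depth-≤-walk (step u~v (walkToRoot v))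

  depth-walk : ∀ {a b m} → Walk (adj G) a b m → depth a ≤ m + depth b
  depth-walk here = ≤-refl
  depth-walk (step a~w walk) = ≤-trans (depth-adj a~w) (s≤s (depth-walk walk))

  depth-walk′ : ∀ {a b m} → Walk (adj G) a b m → depth b ≤ m + depth a
  depth-walk′ here = ≤-refl
  depth-walk′ {a} (step {m = m} a~w walk) = begin
    _                     ≤⟨ depth-walk′ walk ⟩
    m + _                 ≤⟨ +-monoʳ-≤ m (depth-adj (~-sym a~w)) ⟩
    m + suc (depth a)     ≡⟨ +-suc m (depth a) ⟩
    suc m + depth a       ∎
    where open ≤-Reasoning

  private
    parentStep : ∀ {v m} → Walk (adj G) v r m → m ≡ depth v → v ≢ r →
      ∃[ w ] (v ~ w × suc (depth w) ≡ depth v)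
    parentStep here _ v≢r = ⊥-elim (v≢r refl)
    parentStep (step {w = w} v~w walk) m≡depth _ =
      w , v~w , ≤-antisym (subst (suc (depth w) ≤_) m≡depth (s≤s (depth-≤-walk walk))) (depth-adj v~w)

    parentBy : ∀ v → Dec (v ≡ r) → Fin n
    parentBy v (yes _) = r
    parentBy v (no v≢r) = proj₁ (parentStep (walkToRoot v) refl v≢r)

  parent : Fin n → Fin n
  parent v = parentBy v (v ≟F r)

  parent-root : parent r ≡ r
  parent-root with r ≟F r
  ... | yes _ = refl
  ... | no r≢r = ⊥-elim (r≢r refl)

  parent-adj : ∀ {v} → v ≢ r → v ~ parent v
  parent-adj {v} v≢r = go (v ≟F r)
    where
    go : (v≟r : Dec (v ≡ r)) → v ~ parentBy v v≟r
    go (yes v≡r) = ⊥-elim (v≢r v≡r)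
    go (no v≢r′) = proj₁ (proj₂ (parentStep (walkToRoot v) refl v≢r′))

  depth-parent-suc : ∀ {v} → v ≢ r → suc (depth (parent v)) ≡ depth v
  depth-parent-suc {v} v≢r = go (v ≟F r)
    where
    go : (v≟r : Dec (v ≡ r)) → suc (depth (parentBy v v≟r)) ≡ depth v
    go (yes v≡r) = ⊥-elim (v≢r v≡r)
    go (no v≢r′) = proj₂ (proj₂ (parentStep (walkToRoot v) refl v≢r′))

  depth-parent : ∀ v → depth (parent v) ≡ depth v ∸ 1
  depth-parent v = go (v ≟F r)
    where
    open ≡-Reasoning
    go : Dec (v ≡ r) → depth (parent v) ≡ depth v ∸ 1
    go (no v≢r) = cong (_∸ 1) (depth-parent-suc v≢r)
    go (yes refl) = begin
      depth (parent r)   ≡⟨ cong depth parent-root ⟩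
      depth r            ≡⟨ depth-root ⟩
      0                  ≡⟨ cong (_∸ 1) depth-root ⟨
      depth r ∸ 1        ∎

  parent^ : ℕ → Fin n → Fin n
  parent^ zero v = v
  parent^ (suc i) v = parent^ i (parent v)

  parent^-suc : ∀ i v → parent^ (suc i) v ≡ parent (parent^ i v)
  parent^-suc zero v = refl
  parent^-suc (suc i) v = parent^-suc i (parent v)

  parent^-+ : ∀ i j v → parent^ i (parent^ j v) ≡ parent^ (j + i) v
  parent^-+ i zero v = refl
  parent^-+ i (suc j) v = parent^-+ i j (parent v)

  depth-parent^ : ∀ i v → depth (parent^ i v) ≡ depth v ∸ i
  depth-parent^ zero v = refl
  depth-parent^ (suc i) v =
    trans (depth-parent^ i (parent v)) (trans (cong (_∸ i) (depth-parent v)) (∸-+-assoc (depth v) 1 i))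

  parent^-depth-root : ∀ v → parent^ (depth v) v ≡ r
  parent^-depth-root v = depth≡0⇒root (trans (depth-parent^ (depth v) v) (n∸n≡0 (depth v)))

  parent^-nonroot : ∀ i v → i < depth v → parent^ i v ≢ r
  parent^-nonroot i v i<depth = depth>0⇒nonroot (subst (0 <_) (sym (depth-parent^ i v)) (m<n⇒0<n∸m i<depth))

module Acyclic {n : ℕ} (G : Graph n) (connected : Connected G) (acyclic : ¬ HasCycle G) (r : Fin n) where

  open Rooted G connected r public

  sameDepth⇒meetAtRoot : ∀ a b → depth a ≡ depth b → parent^ (depth a) a ≡ parent^ (depth a) b
  sameDepth⇒meetAtRoot a b same-depth =
    trans (parent^-depth-root a) (sym (subst (λ t → parent^ t b ≡ r) (sym same-depth) (parent^-depth-root b)))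

  meetingIndex : ∀ a b → a ≢ b → depth a ≡ depth b →
    ∃[ j ] (1 ≤ j × j ≤ depth a × parent^ j a ≡ parent^ j b × (∀ i → i < j → parent^ i a ≢ parent^ i b))
  meetingIndex a b a≢b same-depth with least (λ j → parent^ j a ≡ parent^ j b)
    (λ j → parent^ j a ≟F parent^ j b) (depth a) (sameDepth⇒meetAtRoot a b same-depth)
  ... | zero , a≡b , _ = ⊥-elim (a≢b a≡b)
  ... | suc j , meet , before = suc j , s≤s z≤n , j<depth , meet , before
    where
    j<depth : suc j ≤ depth a
    j<depth with suc j ≤? depth a
    ... | yes j<d = j<d
    ... | no j≮d = ⊥-elim (before (depth a) (≰⇒> j≮d) (sameDepth⇒meetAtRoot a b same-depth))

  -- The walk a, parent a, …, parent^j a = parent^j b, …, parent b, b, of length 2j.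
  module UpDownPath (a b : Fin n) (j : ℕ) (same-depth : depth a ≡ depth b)
    (1≤j : 1 ≤ j) (j≤depth : j ≤ depth a)
    (meet : parent^ j a ≡ parent^ j b) (before : ∀ i → i < j → parent^ i a ≢ parent^ i b) where

    h : ℕ
    h = depth a

    path : ℕ → Fin n
    path i with i ≤? j
    ... | yes _ = parent^ i a
    ... | no _ = parent^ ((j + j) ∸ i) b

    path-up : ∀ i → i ≤ j → path i ≡ parent^ i a
    path-up i i≤j with i ≤? j
    ... | yes _ = refl
    ... | no i≰j = ⊥-elim (i≰j i≤j)

    path-down : ∀ i → j ≤ i → path i ≡ parent^ ((j + j) ∸ i) b
    path-down i j≤i with i ≤? j
    ... | no _ = refl
    ... | yes i≤j with ≤-antisym i≤j j≤i
    ... | refl = trans meet (cong (λ t → parent^ t b) (sym (m+n∸n≡m j j)))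

    depth-up : ∀ i → depth (parent^ i a) ≡ h ∸ i
    depth-up i = depth-parent^ i a

    depth-down : ∀ i → depth (parent^ i b) ≡ h ∸ i
    depth-down i = trans (depth-parent^ i b) (cong (_∸ i) (sym same-depth))

    mirror≤j : ∀ i → j ≤ i → (j + j) ∸ i ≤ j
    mirror≤j i j≤i = ≤-trans (∸-monoʳ-≤ (j + j) j≤i) (≤-reflexive (m+n∸n≡m j j))

    mirror-suc : ∀ i → i < j + j → (j + j) ∸ i ≡ suc ((j + j) ∸ suc i)
    mirror-suc i i<2j = +-∸-assoc 1 i<2j

    path-adjacent : ∀ i → i < j + j → path i ~ path (suc i)
    path-adjacent i i<2j = go (suc i ≤? j)
      where
      go : Dec (suc i ≤ j) → path i ~ path (suc i)
      go (yes i<j) = subst₂ _~_ (sym (path-up i (≤-trans (n≤1+n i) i<j)))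
        (trans (sym (parent^-suc i a)) (sym (path-up (suc i) i<j)))
        (parent-adj (parent^-nonroot i a (≤-trans i<j j≤depth)))
      go (no i≮j) = subst₂ _~_
        (sym (trans (path-down i j≤i) (trans (cong (λ t → parent^ t b) (mirror-suc i i<2j)) (parent^-suc t b))))
        (sym (path-down (suc i) (≤-trans j≤i (n≤1+n i))))
        (~-sym (parent-adj (parent^-nonroot t b (subst (t <_) same-depth (<-≤-trans t<j j≤depth)))))
        where
        j≤i : j ≤ i
        j≤i = ≤-pred (≰⇒> i≮j)
        t : ℕ
        t = (j + j) ∸ suc i
        t<j : t < j
        t<j = subst (_≤ j) (mirror-suc i i<2j) (mirror≤j i j≤i)

    depth-path : ∀ i → depth (path i) ≤ h
    depth-path i = go (i ≤? j)
      where
      go : Dec (i ≤ j) → depth (path i) ≤ h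
      go (yes i≤j) = subst (_≤ h) (sym (trans (cong depth (path-up i i≤j)) (depth-up i))) (m∸n≤m h i)
      go (no i≰j) = subst (_≤ h)
        (sym (trans (cong depth (path-down i (<⇒≤ (≰⇒> i≰j)))) (depth-down ((j + j) ∸ i))))
        (m∸n≤m h ((j + j) ∸ i))

    path-start : path 0 ≡ a
    path-start = path-up 0 z≤n

    path-end : path (j + j) ≡ b
    path-end = trans (path-down (j + j) (m≤m+n j j)) (cong (λ t → parent^ t b) (n∸n≡0 (j + j)))

    private
      upDown-injective : ∀ i i′ → i ≤ j → j ≤ i′ → i′ ≤ j + j →
        parent^ i a ≡ parent^ ((j + j) ∸ i′) b → i ≡ i′
      upDown-injective i i′ i≤j j≤i′ i′≤2j eq = trans i≡j (sym i′≡j)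
        where
        t : ℕ
        t = (j + j) ∸ i′
        i≡t : i ≡ t
        i≡t = ∸-cancelˡ-≡ (≤-trans i≤j j≤depth) (≤-trans (mirror≤j i′ j≤i′) j≤depth)
          (trans (sym (depth-up i)) (trans (cong depth eq) (depth-down t)))
        i≡j : i ≡ j
        i≡j with m≤n⇒m<n∨m≡n i≤j
        ... | inj₂ i≡j = i≡j
        ... | inj₁ i<j = ⊥-elim (before i i<j (trans eq (cong (λ x → parent^ x b) (sym i≡t))))
        i′≡j : i′ ≡ j
        i′≡j = ∸-cancelˡ-≡ i′≤2j (m≤m+n j j) (trans (sym i≡t) (trans i≡j (sym (m+n∸n≡m j j))))

    path-injective : ∀ i i′ → i ≤ j + j → i′ ≤ j + j → path i ≡ path i′ → i ≡ i′
    path-injective i i′ i≤2j i′≤2j eq = go (i ≤? j) (i′ ≤? j)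
      where
      go : Dec (i ≤ j) → Dec (i′ ≤ j) → i ≡ i′
      go (yes i≤j) (yes i′≤j) = ∸-cancelˡ-≡ (≤-trans i≤j j≤depth) (≤-trans i′≤j j≤depth)
        (trans (sym (depth-up i)) (trans (cong depth (trans (sym (path-up i i≤j)) (trans eq (path-up i′ i′≤j))))
          (depth-up i′)))
      go (yes i≤j) (no i′≰j) = upDown-injective i i′ i≤j j≤i′ i′≤2j
        (trans (sym (path-up i i≤j)) (trans eq (path-down i′ j≤i′)))
        where
        j≤i′ : j ≤ i′
        j≤i′ = <⇒≤ (≰⇒> i′≰j)
      go (no i≰j) (yes i′≤j) = sym (upDown-injective i′ i i′≤j j≤i i≤2j
        (trans (sym (path-up i′ i′≤j)) (trans (sym eq) (path-down i j≤i))))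
        where
        j≤i : j ≤ i
        j≤i = <⇒≤ (≰⇒> i≰j)
      go (no i≰j) (no i′≰j) = ∸-cancelˡ-≡ i≤2j i′≤2j
        (∸-cancelˡ-≡ (≤-trans (mirror≤j i j≤i) j≤depth) (≤-trans (mirror≤j i′ j≤i′) j≤depth)
          (trans (sym (depth-down ((j + j) ∸ i)))
            (trans (cong depth (trans (sym (path-down i j≤i)) (trans eq (path-down i′ j≤i′))))
              (depth-down ((j + j) ∸ i′)))))
        where
        j≤i : j ≤ i
        j≤i = <⇒≤ (≰⇒> i≰j)
        j≤i′ : j ≤ i′
        j≤i′ = <⇒≤ (≰⇒> i′≰j)

    cycle-via-edge : b ~ a → HasCycle G
    cycle-via-edge b~a = closedWalk⇒hasCycle G (j + j) (+-mono-≤ 1≤j 1≤j) path path-adjacent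
      (subst₂ _~_ (sym path-end) (sym path-start) b~a) path-injective

    -- v lies strictly below the whole path, so prepending it keeps the walk injective.
    cycle-via-common-neighbour : ∀ v → depth v ≡ suc h → v ~ a → v ~ b → HasCycle G
    cycle-via-common-neighbour v depth-v v~a v~b =
      closedWalk⇒hasCycle G (suc (j + j)) (s≤s (≤-trans 1≤j (m≤m+n j j))) f consecutive closing injective
      where
      f : ℕ → Fin n
      f zero = v
      f (suc i) = path i
      consecutive : ∀ i → i < suc (j + j) → f i ~ f (suc i)
      consecutive zero _ = subst (v ~_) (sym path-start) v~a
      consecutive (suc i) (s≤s i<2j) = path-adjacent i i<2j
      closing : f (suc (j + j)) ~ v
      closing = subst (_~ v) (sym path-end) (~-sym v~b)
      v∉path : ∀ i → v ≢ path i
      v∉path i v≡ = <-irrefl refl (≤-trans (≤-reflexive (trans (sym depth-v) (cong depth v≡))) (depth-path i))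
      injective : ∀ i i′ → i ≤ suc (j + j) → i′ ≤ suc (j + j) → f i ≡ f i′ → i ≡ i′
      injective zero zero _ _ _ = refl
      injective zero (suc i′) _ _ eq = ⊥-elim (v∉path i′ eq)
      injective (suc i) zero _ _ eq = ⊥-elim (v∉path i (sym eq))
      injective (suc i) (suc i′) (s≤s i≤) (s≤s i′≤) eq = cong suc (path-injective i i′ i≤ i′≤ eq)

  no-edge-within-level : ∀ {a b} → a ≢ b → depth a ≡ depth b → ¬ (b ~ a)
  no-edge-within-level {a} {b} a≢b same-depth b~a with meetingIndex a b a≢b same-depth
  ... | j , 1≤j , j≤depth , meet , before =
    acyclic (UpDownPath.cycle-via-edge a b j same-depth 1≤j j≤depth meet before b~a)

  no-common-child : ∀ {v a b} → a ≢ b → depth a ≡ depth b → depth v ≡ suc (depth a) → v ~ a → ¬ (v ~ b)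
  no-common-child {v} {a} {b} a≢b same-depth depth-v v~a v~b with meetingIndex a b a≢b same-depth
  ... | j , 1≤j , j≤depth , meet , before =
    acyclic (UpDownPath.cycle-via-common-neighbour a b j same-depth 1≤j j≤depth meet before v depth-v v~a v~b)

  IsChildOf : Fin n → Fin n → Set
  IsChildOf u v = u ≢ r × parent u ≡ v

  isChildOf? : ∀ u v → Dec (IsChildOf u v)
  isChildOf? u v = ¬? (u ≟F r) ×-dec (parent u ≟F v)

  private
    deeperNeighbour-isChild : ∀ {v w} → v ~ w → depth w ≡ suc (depth v) → IsChildOf w v
    deeperNeighbour-isChild {v} {w} v~w depth-w = w≢r , parent≡v
      where
      w≢r : w ≢ r
      w≢r = depth>0⇒nonroot (subst (0 <_) (sym depth-w) (s≤s z≤n))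
      parent≡v : parent w ≡ v
      parent≡v with parent w ≟F v
      ... | yes eq = eq
      ... | no parent≢v = ⊥-elim (no-common-child parent≢v same-depth
        (trans depth-w (cong suc (sym same-depth))) (parent-adj w≢r) (~-sym v~w))
        where
        same-depth : depth (parent w) ≡ depth v
        same-depth = suc-injective (trans (depth-parent-suc w≢r) depth-w)

  edge⇒parentEdge : ∀ {u v} → u ~ v → IsChildOf u v ⊎ IsChildOf v u
  edge⇒parentEdge {u} {v} u~v with <-cmp (depth u) (depth v)
  ... | tri< u<v _ _ = inj₂ (deeperNeighbour-isChild u~v (≤-antisym (depth-adj (~-sym u~v)) u<v))
  ... | tri> _ _ u>v = inj₁ (deeperNeighbour-isChild (~-sym u~v) (≤-antisym (depth-adj u~v) u>v))
  ... | tri≈ _ same _ = ⊥-elim (no-edge-within-level (loopless ∘ sym) (sym same) u~v)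
    where
    loopless : u ≢ v
    loopless refl with trans (sym u~v) (Graph.irrefl G u)
    ... | ()

  nonRootCount : ℕ
  nonRootCount = ∑[ v < n ] decToℕ (¬? (v ≟F r))

  childIndicator : Fin n → Fin n → ℕ
  childIndicator u v = decToℕ (isChildOf? u v)

  parentIndicator : Fin n → Fin n → ℕ
  parentIndicator u v = childIndicator v u

  edgeIndicator : Fin n → Fin n → ℕ
  edgeIndicator u v = boolToℕ (adj G u v)

  parentCount≤nonRoot : ∀ u → ∑[ v < n ] childIndicator u v ≤ decToℕ (¬? (u ≟F r))
  parentCount≤nonRoot u = begin
    ∑[ v < n ] childIndicator u v   ≡⟨ sum-single (childIndicator u) (parent u) off-parent ⟩
    childIndicator u (parent u)     ≤⟨ at-parent (isChildOf? u (parent u)) ⟩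
    decToℕ (¬? (u ≟F r))            ∎
    where
    open ≤-Reasoning
    off-parent : ∀ v → v ≢ parent u → childIndicator u v ≡ 0
    off-parent v v≢parent = decToℕ-no (isChildOf? u v) (λ (_ , parent≡v) → v≢parent (sym parent≡v))
    at-parent : (u-child? : Dec (IsChildOf u (parent u))) → decToℕ u-child? ≤ decToℕ (¬? (u ≟F r))
    at-parent (yes (u≢r , _)) = ≤-reflexive (sym (decToℕ-yes (¬? (u ≟F r)) u≢r))
    at-parent (no _) = z≤n

  edge≤childIndicators : ∀ i j →
    upper edgeIndicator i j ≤ upper childIndicator i j + upper parentIndicator i j
  edge≤childIndicators i j with toℕ i <? toℕ j
  ... | no _ = z≤n
  ... | yes _ with adj G i j in i~j
  ... | false = z≤n
  ... | true with edge⇒parentEdge i~j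
  ... | inj₁ i-child = ≤-trans (≤-reflexive (sym (decToℕ-yes (isChildOf? i j) i-child))) (m≤m+n _ _)
  ... | inj₂ j-child = ≤-trans (≤-reflexive (sym (decToℕ-yes (isChildOf? j i) j-child))) (m≤n+m _ _)

  edgeCount≤nonRootCount : edgeCount {G = G} (wholeSubgraph G) ≤ nonRootCount
  edgeCount≤nonRootCount = begin
    edgeCount {G = G} (wholeSubgraph G)
      ≡⟨ trans (sum-allFin n _) (sum-cong-≗ {n} (λ i → sum-allFin n _)) ⟩
    ∑[ i < n ] ∑[ j < n ] upper edgeIndicator i j
      ≤⟨ sum-mono-≤ (λ i → sum-mono-≤ (edge≤childIndicators i)) ⟩
    ∑[ i < n ] ∑[ j < n ] (upper childIndicator i j + upper parentIndicator i j)
      ≤⟨ sum-upper+upper≤sum childIndicator ⟩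
    ∑[ i < n ] ∑[ j < n ] childIndicator i j
      ≤⟨ sum-mono-≤ parentCount≤nonRoot ⟩
    nonRootCount ∎
    where open ≤-Reasoning

module LeafRooted {n : ℕ} (G : Graph n) (connected : Connected G) (acyclic : ¬ HasCycle G)
  (r : Fin n) (r-pendant : degree G r ≡ 1)
  (d : ℕ) (within-d : ∀ u v → ∃[ m ] (m ≤ d × Walk (adj G) u v m)) where

  open Acyclic G connected acyclic r public

  degree-sum : ∀ v → degree G v ≡ ∑[ j < n ] boolToℕ (adj G v j)
  degree-sum v = sum-allFin n (λ j → boolToℕ (adj G v j))

  depth≤d : ∀ v → depth v ≤ d
  depth≤d v with within-d v r
  ... | m , m≤d , walk = ≤-trans (depth-≤-walk walk) m≤d

  private
    rootNeighbour : ∃[ c ] (r ~ c)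
    rootNeighbour with positive-term (λ j → boolToℕ (adj G r j)) (subst (0 <_) (degree-sum r) degree>0)
      where
      degree>0 : 0 < degree G r
      degree>0 = subst (0 <_) (sym r-pendant) (s≤s z≤n)
    ... | c , r~c = c , boolToℕ-positive r~c

  rootChild : Fin n
  rootChild = proj₁ rootNeighbour

  rootChild-isChild : IsChildOf rootChild r
  rootChild-isChild with edge⇒parentEdge (proj₂ rootNeighbour)
  ... | inj₁ (r≢r , _) = ⊥-elim (r≢r refl)
  ... | inj₂ c-child = c-child

  depth≡1⇒rootChild : ∀ {z} → depth z ≡ 1 → z ≡ rootChild
  depth≡1⇒rootChild {z} depth≡1 with z ≟F rootChild
  ... | yes z≡c = z≡c
  ... | no z≢c = ⊥-elim (1+n≰n (begin
    2                                                   ≡⟨ cong₂ _+_ (cong boolToℕ r~z) (cong boolToℕ r~c) ⟨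
    boolToℕ (adj G r z) + boolToℕ (adj G r rootChild)
      ≤⟨ twoTerms≤sum (λ j → boolToℕ (adj G r j)) z rootChild z≢c ⟩
    ∑[ j < n ] boolToℕ (adj G r j)                      ≡⟨ degree-sum r ⟨
    degree G r                                          ≡⟨ r-pendant ⟩
    1                                                   ∎))
    where
    open ≤-Reasoning
    z≢r : z ≢ r
    z≢r = depth>0⇒nonroot (subst (0 <_) (sym depth≡1) (s≤s z≤n))
    r~z : r ~ z
    r~z = ~-sym (subst (z ~_) (depth≡0⇒root (trans (depth-parent z) (cong (_∸ 1) depth≡1))) (parent-adj z≢r))
    r~c : r ~ rootChild
    r~c = proj₂ rootNeighbour

  HasChild : Fin n → Set
  HasChild x = ∃[ w ] IsChildOf w x

  hasChild? : ∀ x → Dec (HasChild x)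
  hasChild? x = any? (λ w → isChildOf? w x)

  IsLeaf : Fin n → Set
  IsLeaf ℓ = ℓ ≢ r × ¬ HasChild ℓ

  isLeaf? : ∀ ℓ → Dec (IsLeaf ℓ)
  isLeaf? ℓ = ¬? (ℓ ≟F r) ×-dec ¬? (hasChild? ℓ)

  -- The number of parent steps is forced by the depths, which makes ≼ decidable.
  infix 4 _≼_
  _≼_ : Fin n → Fin n → Set
  x ≼ y = parent^ (depth y ∸ depth x) y ≡ x

  _≼?_ : ∀ x y → Dec (x ≼ y)
  x ≼? y = parent^ (depth y ∸ depth x) y ≟F x

  ≼-intro : ∀ {x y} i → parent^ i y ≡ x → x ≼ y
  ≼-intro {x} {y} i eq with i ≤? depth y
  ... | yes i≤depth = trans (cong (λ t → parent^ t y) steps≡i) eq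
    where
    steps≡i : depth y ∸ depth x ≡ i
    steps≡i = trans (cong (depth y ∸_) (trans (sym (cong depth eq)) (depth-parent^ i y))) (m∸[m∸n]≡n i≤depth)
  ... | no i≰depth = trans (depth≡0⇒root depth-top) (sym (depth≡0⇒root depth-x))
    where
    depth-x : depth x ≡ 0
    depth-x = trans (sym (cong depth eq)) (trans (depth-parent^ i y) (m≤n⇒m∸n≡0 (<⇒≤ (≰⇒> i≰depth))))
    depth-top : depth (parent^ (depth y ∸ depth x) y) ≡ 0
    depth-top = trans (depth-parent^ (depth y ∸ depth x) y)
      (trans (cong (λ t → depth y ∸ (depth y ∸ t)) depth-x) (n∸n≡0 (depth y)))

  ≼-refl : ∀ x → x ≼ x
  ≼-refl x = ≼-intro {y = x} 0 refl

  parent-≼ : ∀ x → parent x ≼ x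
  parent-≼ x = ≼-intro {y = x} 1 refl

  ≼-trans : ∀ {x y z} → x ≼ y → y ≼ z → x ≼ z
  ≼-trans {x} {y} {z} x≼y y≼z = ≼-intro (i + j)
    (trans (sym (parent^-+ j i z)) (trans (cong (parent^ j) y≼z) x≼y))
    where
    i j : ℕ
    i = depth z ∸ depth y
    j = depth y ∸ depth x

  ≼-depth : ∀ {x y} → x ≼ y → depth x ≤ depth y
  ≼-depth {x} {y} x≼y =
    subst (_≤ depth y) (trans (sym (depth-parent^ (depth y ∸ depth x) y)) (cong depth x≼y))
      (m∸n≤m (depth y) (depth y ∸ depth x))

  LeafBelow : Fin n → Fin n → Set
  LeafBelow x ℓ = IsLeaf ℓ × x ≼ ℓ

  leafBelow? : ∀ x ℓ → Dec (LeafBelow x ℓ)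
  leafBelow? x ℓ = isLeaf? ℓ ×-dec (x ≼? ℓ)

  private
    descend : ∀ fuel x → d < depth x + fuel → ∃[ ℓ ] (¬ HasChild ℓ × x ≼ ℓ)
    descend zero x d<depth = ⊥-elim (<⇒≱ d<depth (subst (_≤ d) (sym (+-identityʳ (depth x))) (depth≤d x)))
    descend (suc fuel) x d<depth+fuel with hasChild? x
    ... | no childless = x , childless , ≼-refl x
    ... | yes (w , w≢r , parent≡x) with descend fuel w (subst (d <_) shift d<depth+fuel)
      where
      shift : depth x + suc fuel ≡ depth w + fuel
      shift = trans (+-suc (depth x) fuel)
        (cong (_+ fuel) (trans (cong (λ t → suc (depth t)) (sym parent≡x)) (depth-parent-suc w≢r)))
    ... | ℓ , childless , w≼ℓ = ℓ , childless , ≼-trans (subst (_≼ w) parent≡x (parent-≼ w)) w≼ℓ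

  someLeafBelow : ∀ x → ∃[ ℓ ] LeafBelow x ℓ
  someLeafBelow x with descend (suc d) x (≤-trans (s≤s (m≤n+m d (depth x))) (≤-reflexive (sym (+-suc (depth x) d))))
  ... | ℓ , childless , x≼ℓ = ℓ , (ℓ≢r , childless) , x≼ℓ
    where
    ℓ≢r : ℓ ≢ r
    ℓ≢r refl = childless (rootChild , rootChild-isChild)

  rank : Fin n → ℕ
  rank v = depth v * n + toℕ v

  rank-< : ∀ a b → depth a < depth b → rank a < rank b
  rank-< a b a<b = begin-strict
    depth a * n + toℕ a    <⟨ +-monoʳ-< (depth a * n) (toℕ<n a) ⟩
    depth a * n + n        ≡⟨ +-comm (depth a * n) n ⟩
    suc (depth a) * n      ≤⟨ *-monoˡ-≤ n a<b ⟩
    depth b * n            ≤⟨ m≤m+n (depth b * n) (toℕ b) ⟩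
    rank b                 ∎
    where open ≤-Reasoning

  rank-≤⇒depth-≤ : ∀ a b → rank a ≤ rank b → depth a ≤ depth b
  rank-≤⇒depth-≤ a b ra≤rb with depth a ≤? depth b
  ... | yes da≤db = da≤db
  ... | no da≰db = ⊥-elim (<⇒≱ (rank-< b a (≰⇒> da≰db)) ra≤rb)

  rank-injective : ∀ a b → rank a ≡ rank b → a ≡ b
  rank-injective a b eq with <-cmp (depth a) (depth b)
  ... | tri< a<b _ _ = ⊥-elim (<⇒≢ (rank-< a b a<b) eq)
  ... | tri> _ _ a>b = ⊥-elim (<⇒≢ (rank-< b a a>b) (sym eq))
  ... | tri≈ _ same _ = toℕ-injective (+-cancelˡ-≡ (depth a * n) (toℕ a) (toℕ b)
    (trans eq (cong (λ t → t * n + toℕ b) (sym same))))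

  heavyLeaf : Fin n → Fin n
  heavyLeaf x = ArgMax.argmax (leafBelow? x) rank (allFin n) (proj₁ (someLeafBelow x))

  heavyLeaf-below : ∀ x → LeafBelow x (heavyLeaf x)
  heavyLeaf-below x = ArgMax.argmax-satisfies (leafBelow? x) rank (allFin n) _ (proj₂ (someLeafBelow x))

  heavyLeaf-maximal : ∀ x ℓ → LeafBelow x ℓ → rank ℓ ≤ rank (heavyLeaf x)
  heavyLeaf-maximal x ℓ = ArgMax.argmax-maximal (leafBelow? x) rank (allFin n) _ ℓ (∈-allFin ℓ)

  heavyLeaf-inherited : ∀ {x y} → y ≼ x → x ≼ heavyLeaf y → heavyLeaf x ≡ heavyLeaf y
  heavyLeaf-inherited {x} {y} y≼x x≼hy = rank-injective (heavyLeaf x) (heavyLeaf y) (≤-antisym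
    (heavyLeaf-maximal y (heavyLeaf x) (proj₁ (heavyLeaf-below x) , ≼-trans y≼x (proj₂ (heavyLeaf-below x))))
    (heavyLeaf-maximal x (heavyLeaf y) (proj₁ (heavyLeaf-below y) , x≼hy)))

  -- In a tree, the only edge leaving the subtree of x is the one to its parent.
  walk-leaves-through-parent : ∀ x {u w m} → x ≼ u → ¬ x ≼ w → Walk (adj G) u w m →
    ∃[ m₁ ] ∃[ m₂ ] (m₁ + m₂ ≤ m × Walk (adj G) u (parent x) m₁ × Walk (adj G) (parent x) w m₂)
  walk-leaves-through-parent x x≼u x⋠w here = ⊥-elim (x⋠w x≼u)
  walk-leaves-through-parent x {u} {w} x≼u x⋠w (step {w = u′} {m = m} u~u′ walk) with x ≼? u′
  ... | yes x≼u′ with walk-leaves-through-parent x x≼u′ x⋠w walk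
  ... | m₁ , m₂ , m₁+m₂≤m , walk₁ , walk₂ = suc m₁ , m₂ , s≤s m₁+m₂≤m , step u~u′ walk₁ , walk₂
  walk-leaves-through-parent x {u} {w} x≼u x⋠w (step {w = u′} {m = m} u~u′ walk) | no x⋠u′
    with edge⇒parentEdge u~u′
  ... | inj₂ (_ , parent≡u) = ⊥-elim (x⋠u′ (≼-trans x≼u (subst (_≼ u′) parent≡u (parent-≼ u′))))
  ... | inj₁ (_ , parent≡u′) = exitAt (depth u ∸ depth x) x≼u
    where
    exitAt : ∀ i → parent^ i u ≡ x →
      ∃[ m₁ ] ∃[ m₂ ] (m₁ + m₂ ≤ suc m × Walk (adj G) u (parent x) m₁ × Walk (adj G) (parent x) w m₂)
    exitAt zero refl = 1 , m , ≤-refl , step (subst (u ~_) (sym parent≡u′) u~u′) here ,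
      subst (λ t → Walk (adj G) t w m) (sym parent≡u′) walk
    exitAt (suc i) parent^≡x =
      ⊥-elim (x⋠u′ (≼-intro {y = u′} i (trans (cong (parent^ i) (sym parent≡u′)) parent^≡x)))

  -- The heavy leaf ℓ′ of parent x is at least as deep as ℓ, and the walk from ℓ to ℓ′
  -- passes through parent x.
  branch-bound : ∀ {x} → heavyLeaf (parent x) ≢ heavyLeaf x →
    let t = depth (heavyLeaf x) ∸ depth (parent x) in t + t ≤ d
  branch-bound {x} branches with within-d (heavyLeaf x) (heavyLeaf (parent x))
  ... | m , m≤d , walk with walk-leaves-through-parent x (proj₂ (heavyLeaf-below x)) x⋠ℓ′ walk
    where
    x⋠ℓ′ : ¬ x ≼ heavyLeaf (parent x)
    x⋠ℓ′ x≼ℓ′ = branches (sym (heavyLeaf-inherited (parent-≼ x) x≼ℓ′))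
  ... | m₁ , m₂ , m₁+m₂≤m , walk₁ , walk₂ = begin
    t + t                       ≤⟨ +-monoʳ-≤ t (∸-monoˡ-≤ (depth p) ℓ-not-deeper) ⟩
    t + (depth ℓ′ ∸ depth p)    ≤⟨ +-mono-≤ up down ⟩
    m₁ + m₂                     ≤⟨ m₁+m₂≤m ⟩
    m                           ≤⟨ m≤d ⟩
    d                           ∎
    where
    open ≤-Reasoning
    p ℓ ℓ′ : Fin n
    p = parent x
    ℓ = heavyLeaf x
    ℓ′ = heavyLeaf p
    t : ℕ
    t = depth ℓ ∸ depth p
    ℓ-not-deeper : depth ℓ ≤ depth ℓ′
    ℓ-not-deeper = rank-≤⇒depth-≤ ℓ ℓ′ (heavyLeaf-maximal p ℓ
      (proj₁ (heavyLeaf-below x) , ≼-trans (parent-≼ x) (proj₂ (heavyLeaf-below x))))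
    up : t ≤ m₁
    up = m≤n+o⇒m∸n≤o (depth ℓ) (depth p) (subst (depth ℓ ≤_) (+-comm m₁ _) (depth-walk walk₁))
    down : depth ℓ′ ∸ depth p ≤ m₂
    down = m≤n+o⇒m∸n≤o (depth ℓ′) (depth p) (subst (depth ℓ′ ≤_) (+-comm m₂ _) (depth-walk′ walk₂))

  Fibre : Fin n → Fin n → Set
  Fibre ℓ v = v ≢ r × heavyLeaf v ≡ ℓ

  fibre? : ∀ ℓ v → Dec (Fibre ℓ v)
  fibre? ℓ v = ¬? (v ≟F r) ×-dec (heavyLeaf v ≟F ℓ)

  fibre-≼ : ∀ {ℓ v} → Fibre ℓ v → v ≼ ℓ
  fibre-≼ {v = v} (_ , refl) = proj₂ (heavyLeaf-below v)

  fibre⊆path : ∀ {ℓ v} → Fibre ℓ v → ∃[ i ] (i < d × parent^ i ℓ ≡ v)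
  fibre⊆path {ℓ} {v} fibre@(v≢r , _) = depth ℓ ∸ depth v ,
    <-≤-trans (∸-monoʳ-< {o = 0} (nonroot⇒depth>0 v≢r) (≼-depth (fibre-≼ fibre))) (depth≤d ℓ) ,
    fibre-≼ fibre

  mainLeaf : Fin n
  mainLeaf = heavyLeaf rootChild

  -- Climbing from v, the heavy leaf changes before rootChild is reached; the vertex x
  -- where it changes satisfies branch-bound, and v lies below x.
  fibre⊆halfPath : ∀ {ℓ v} → ℓ ≢ mainLeaf → Fibre ℓ v → ∃[ i ] (i < ⌊ d /2⌋ × parent^ i ℓ ≡ v)
  fibre⊆halfPath {ℓ} {v} ℓ≢main fibre@(v≢r , hv≡ℓ)
    with lastBefore (λ s → heavyLeaf (parent^ s v) ≡ ℓ) (λ s → heavyLeaf (parent^ s v) ≟F ℓ)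
           (depth v ∸ 1) hv≡ℓ top≢ℓ
    where
    top≢ℓ : heavyLeaf (parent^ (depth v ∸ 1) v) ≢ ℓ
    top≢ℓ eq = ℓ≢main (trans (sym eq) (cong heavyLeaf (depth≡1⇒rootChild
      (trans (depth-parent^ (depth v ∸ 1) v) (m∸[m∸n]≡n (nonroot⇒depth>0 v≢r))))))
  ... | s , s<top , hx≡ℓ , hpx≢ℓ =
    depth ℓ ∸ depth v , <-≤-trans i<t (double≤⇒≤half (branch-bound branches)) , fibre-≼ fibre
    where
    x : Fin n
    x = parent^ s v
    branches : heavyLeaf (parent x) ≢ heavyLeaf x
    branches eq = hpx≢ℓ (trans (cong heavyLeaf (parent^-suc s v)) (trans eq hx≡ℓ))
    parent-x-above-v : depth (parent x) < depth v
    parent-x-above-v = subst (_< depth v) (trans (sym (depth-parent^ (suc s) v)) (cong depth (parent^-suc s v)))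
      (∸-monoʳ-< {o = 0} (s≤s z≤n) (≤-trans s<top (m∸n≤m (depth v) 1)))
    i<t : depth ℓ ∸ depth v < depth (heavyLeaf x) ∸ depth (parent x)
    i<t = subst (λ t → depth ℓ ∸ depth v < depth t ∸ depth (parent x)) (sym hx≡ℓ)
      (∸-monoʳ-< parent-x-above-v (≼-depth (fibre-≼ fibre)))

  fibreSize : Fin n → ℕ
  fibreSize ℓ = ∑[ v < n ] decToℕ (fibre? ℓ v)

  nonRootCount≡∑fibreSize : nonRootCount ≡ ∑[ ℓ < n ] fibreSize ℓ
  nonRootCount≡∑fibreSize = trans (sum-cong-≗ {n} inOwnFibre) (∑-comm {n} {n} (λ v ℓ → decToℕ (fibre? ℓ v)))
    where
    inOwnFibre : ∀ v → decToℕ (¬? (v ≟F r)) ≡ ∑[ ℓ < n ] decToℕ (fibre? ℓ v)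
    inOwnFibre v = sym (trans (sum-single _ (heavyLeaf v) otherFibres) (ownFibre (v ≟F r)))
      where
      otherFibres : ∀ ℓ → ℓ ≢ heavyLeaf v → decToℕ (fibre? ℓ v) ≡ 0
      otherFibres ℓ ℓ≢ = decToℕ-no (fibre? ℓ v) (λ (_ , hv≡ℓ) → ℓ≢ (sym hv≡ℓ))
      ownFibre : Dec (v ≡ r) → decToℕ (fibre? (heavyLeaf v) v) ≡ decToℕ (¬? (v ≟F r))
      ownFibre (yes v≡r) = trans (decToℕ-no (fibre? _ v) (λ (v≢r , _) → v≢r v≡r))
        (sym (decToℕ-no (¬? (v ≟F r)) (λ v≢r → v≢r v≡r)))
      ownFibre (no v≢r) = trans (decToℕ-yes (fibre? _ v) (v≢r , refl)) (sym (decToℕ-yes (¬? (v ≟F r)) v≢r))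

  IsOtherLeaf : Fin n → Set
  IsOtherLeaf ℓ = ℓ ≢ mainLeaf × IsLeaf ℓ

  isOtherLeaf? : ∀ ℓ → Dec (IsOtherLeaf ℓ)
  isOtherLeaf? ℓ = ¬? (ℓ ≟F mainLeaf) ×-dec isLeaf? ℓ

  otherLeafCount : ℕ
  otherLeafCount = ∑[ ℓ < n ] decToℕ (isOtherLeaf? ℓ)

  fibreBound : Fin n → ℕ
  fibreBound ℓ = d * decToℕ (mainLeaf ≟F ℓ) + ⌊ d /2⌋ * decToℕ (isOtherLeaf? ℓ)

  fibreSize≤fibreBound : ∀ ℓ → fibreSize ℓ ≤ fibreBound ℓ
  fibreSize≤fibreBound ℓ = go (mainLeaf ≟F ℓ) (isOtherLeaf? ℓ)
    where
    go : (main? : Dec (mainLeaf ≡ ℓ)) (other? : Dec (IsOtherLeaf ℓ)) →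
      fibreSize ℓ ≤ d * decToℕ main? + ⌊ d /2⌋ * decToℕ other?
    go (yes main≡ℓ) (yes (ℓ≢main , _)) = ⊥-elim (ℓ≢main (sym main≡ℓ))
    go (yes _) (no _) = begin
      fibreSize ℓ       ≤⟨ count-≤ (fibre? ℓ) d (λ i → parent^ i ℓ) (λ _ → fibre⊆path) ⟩
      d                 ≡⟨ +-identityʳ d ⟨
      d + 0             ≡⟨ cong₂ _+_ (*-identityʳ d) (*-zeroʳ ⌊ d /2⌋) ⟨
      d * 1 + ⌊ d /2⌋ * 0 ∎
      where open ≤-Reasoning
    go (no _) (yes (ℓ≢main , _)) = begin
      fibreSize ℓ       ≤⟨ count-≤ (fibre? ℓ) ⌊ d /2⌋ (λ i → parent^ i ℓ) (λ _ → fibre⊆halfPath ℓ≢main) ⟩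
      ⌊ d /2⌋           ≡⟨ *-identityʳ ⌊ d /2⌋ ⟨
      ⌊ d /2⌋ * 1       ≡⟨ cong (_+ ⌊ d /2⌋ * 1) (*-zeroʳ d) ⟨
      d * 0 + ⌊ d /2⌋ * 1 ∎
      where open ≤-Reasoning
    go (no main≢ℓ) (no notOther) = ≤-reflexive (trans (sum-zero _ (λ v → decToℕ-no (fibre? ℓ v) emptyFibre))
      (sym (cong₂ _+_ (*-zeroʳ d) (*-zeroʳ ⌊ d /2⌋))))
      where
      emptyFibre : ∀ {v} → ¬ Fibre ℓ v
      emptyFibre {v} (_ , hv≡ℓ) =
        notOther ((λ ℓ≡main → main≢ℓ (sym ℓ≡main)) , subst IsLeaf hv≡ℓ (proj₁ (heavyLeaf-below v)))

  ∑fibreBound : ∑[ ℓ < n ] fibreBound ℓ ≡ d + ⌊ d /2⌋ * otherLeafCount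
  ∑fibreBound = begin
    ∑[ ℓ < n ] fibreBound ℓ
      ≡⟨ ∑-distrib-+ (λ ℓ → d * isMain ℓ) (λ ℓ → ⌊ d /2⌋ * isOther ℓ) ⟩
    ∑[ ℓ < n ] (d * isMain ℓ) + ∑[ ℓ < n ] (⌊ d /2⌋ * isOther ℓ)
      ≡⟨ cong₂ _+_ (*-distribˡ-sum d isMain) (*-distribˡ-sum ⌊ d /2⌋ isOther) ⟨
    d * (∑[ ℓ < n ] isMain ℓ) + ⌊ d /2⌋ * otherLeafCount
      ≡⟨ cong (λ t → d * t + ⌊ d /2⌋ * otherLeafCount) (sum-indicator mainLeaf) ⟩
    d * 1 + ⌊ d /2⌋ * otherLeafCount
      ≡⟨ cong (_+ ⌊ d /2⌋ * otherLeafCount) (*-identityʳ d) ⟩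
    d + ⌊ d /2⌋ * otherLeafCount ∎
    where
    open ≡-Reasoning
    isMain isOther : Fin n → ℕ
    isMain ℓ = decToℕ (mainLeaf ≟F ℓ)
    isOther ℓ = decToℕ (isOtherLeaf? ℓ)

  leaf-degree : ∀ {ℓ} → IsLeaf ℓ → degree G ℓ ≡ 1
  leaf-degree {ℓ} (ℓ≢r , childless) = begin
    degree G ℓ                          ≡⟨ degree-sum ℓ ⟩
    ∑[ j < n ] boolToℕ (adj G ℓ j)      ≡⟨ sum-single _ (parent ℓ) onlyParent ⟩
    boolToℕ (adj G ℓ (parent ℓ))        ≡⟨ cong boolToℕ (parent-adj ℓ≢r) ⟩
    1                                   ∎
    where
    open ≡-Reasoning
    onlyParent : ∀ j → j ≢ parent ℓ → boolToℕ (adj G ℓ j) ≡ 0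
    onlyParent j j≢parent with adj G ℓ j in ℓ~j
    ... | false = refl
    ... | true with edge⇒parentEdge ℓ~j
    ... | inj₁ (_ , parent≡j) = ⊥-elim (j≢parent (sym parent≡j))
    ... | inj₂ j-child = ⊥-elim (childless (j , j-child))

  pendantIndicator : Fin n → ℕ
  pendantIndicator v = boolToℕ (degree G v ≡ᵇ 1)

  degree≡1⇒pendantIndicator≡1 : ∀ {v} → degree G v ≡ 1 → pendantIndicator v ≡ 1
  degree≡1⇒pendantIndicator≡1 deg≡1 = cong (λ t → boolToℕ (t ≡ᵇ 1)) deg≡1

  mainLeaf-isLeaf : IsLeaf mainLeaf
  mainLeaf-isLeaf = proj₁ (heavyLeaf-below rootChild)

  leafIndicators≤pendantIndicator : ∀ ℓ →
    decToℕ (isOtherLeaf? ℓ) + decToℕ (mainLeaf ≟F ℓ) + decToℕ (r ≟F ℓ) ≤ pendantIndicator ℓ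
  leafIndicators≤pendantIndicator ℓ = go (isOtherLeaf? ℓ) (mainLeaf ≟F ℓ) (r ≟F ℓ)
    where
    go : (other? : Dec (IsOtherLeaf ℓ)) (main? : Dec (mainLeaf ≡ ℓ)) (root? : Dec (r ≡ ℓ)) →
      decToℕ other? + decToℕ main? + decToℕ root? ≤ pendantIndicator ℓ
    go (yes (ℓ≢main , _)) (yes main≡ℓ) _ = ⊥-elim (ℓ≢main (sym main≡ℓ))
    go (yes (_ , ℓ≢r , _)) (no _) (yes r≡ℓ) = ⊥-elim (ℓ≢r (sym r≡ℓ))
    go (no _) (yes main≡ℓ) (yes r≡ℓ) = ⊥-elim (proj₁ mainLeaf-isLeaf (trans main≡ℓ (sym r≡ℓ)))
    go (yes (_ , leaf)) (no _) (no _) = ≤-reflexive (sym (degree≡1⇒pendantIndicator≡1 (leaf-degree leaf)))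
    go (no _) (yes refl) (no _) = ≤-reflexive (sym (degree≡1⇒pendantIndicator≡1 (leaf-degree mainLeaf-isLeaf)))
    go (no _) (no _) (yes refl) = ≤-reflexive (sym (degree≡1⇒pendantIndicator≡1 r-pendant))
    go (no _) (no _) (no _) = z≤n

  otherLeafCount+2≤pendantCount : otherLeafCount + 2 ≤ pendantCount G
  otherLeafCount+2≤pendantCount = begin
    otherLeafCount + 2
      ≡⟨ +-assoc otherLeafCount 1 1 ⟨
    otherLeafCount + 1 + 1
      ≡⟨ cong₂ (λ a b → otherLeafCount + a + b) (sum-indicator mainLeaf) (sum-indicator r) ⟨
    ∑[ ℓ < n ] isOther ℓ + ∑[ ℓ < n ] isMain ℓ + ∑[ ℓ < n ] isRoot ℓ
      ≡⟨ cong (_+ ∑[ ℓ < n ] isRoot ℓ) (∑-distrib-+ isOther isMain) ⟨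
    ∑[ ℓ < n ] (isOther ℓ + isMain ℓ) + ∑[ ℓ < n ] isRoot ℓ
      ≡⟨ ∑-distrib-+ (λ ℓ → isOther ℓ + isMain ℓ) isRoot ⟨
    ∑[ ℓ < n ] (isOther ℓ + isMain ℓ + isRoot ℓ)
      ≤⟨ sum-mono-≤ leafIndicators≤pendantIndicator ⟩
    ∑[ ℓ < n ] pendantIndicator ℓ
      ≡⟨ sum-allFin n pendantIndicator ⟨
    pendantCount G ∎
    where
    open ≤-Reasoning
    isOther isMain isRoot : Fin n → ℕ
    isOther ℓ = decToℕ (isOtherLeaf? ℓ)
    isMain ℓ = decToℕ (mainLeaf ≟F ℓ)
    isRoot ℓ = decToℕ (r ≟F ℓ)

  nonRootCount-bound : nonRootCount ≤ d + (pendantCount G ∸ 2) * ⌊ d /2⌋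
  nonRootCount-bound = begin
    nonRootCount                          ≡⟨ nonRootCount≡∑fibreSize ⟩
    ∑[ ℓ < n ] fibreSize ℓ                ≤⟨ sum-mono-≤ fibreSize≤fibreBound ⟩
    ∑[ ℓ < n ] fibreBound ℓ               ≡⟨ ∑fibreBound ⟩
    d + ⌊ d /2⌋ * otherLeafCount          ≡⟨ cong (d +_) (*-comm ⌊ d /2⌋ otherLeafCount) ⟩
    d + otherLeafCount * ⌊ d /2⌋
      ≤⟨ +-monoʳ-≤ d (*-monoˡ-≤ ⌊ d /2⌋ (m+n≤o⇒m≤o∸n otherLeafCount otherLeafCount+2≤pendantCount)) ⟩
    d + (pendantCount G ∸ 2) * ⌊ d /2⌋    ∎
    where open ≤-Reasoning

pendantVertex : ∀ {n} (G : Graph n) → 0 < pendantCount G → ∃[ r ] degree G r ≡ 1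
pendantVertex {n} G pendants>0 with positive-term _ (subst (0 <_) (sum-allFin n _) pendants>0)
... | r , r-pendant = r , ≡ᵇ⇒≡ (degree G r) 1 (subst T (sym (boolToℕ-positive r-pendant)) tt)

corollary2p6 : ∀ (k : ℕ) → 2 ≤ k → ∀ {n : ℕ} (T : Graph n) → IsTree T →
    pendantCount T ≡ k → ∀ (d : ℕ) → IsDiameter T d →
    SteinerDiamLe T k (d + (k ∸ 2) * ⌊ d /2⌋)
corollary2p6 k 2≤k T (connected , acyclic) refl d (within-d , _) _ _ =
  wholeSubgraph T , (λ u v _ _ → connected u v) , (λ _ → ∈⊤) ,
  ≤-trans edgeCount≤nonRootCount nonRootCount-bound
  where
  open LeafRooted T connected acyclic _ (proj₂ (pendantVertex T (≤-trans (s≤s z≤n) 2≤k))) d within-d
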